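{- Let $G$ and $H$ be two connected graphs with $G\neq K_1$. If $D(G)\leqslant D(H)$, then $D(G\circ H)=D(H)$.
   Context: The corona $G\circ H$ is obtained by taking one copy of $G$ and $|V(G)|$ copies of $H$ and joining the $i$-th vertex of $G$ to every vertex of the $i$-th copy of $H$. $K_1$ is the single-vertex graph. The distinguishing number $D(G)$ is the least $r$ such that some vertex labeling $V(G)\to\{1,\dots,r\}$ is preserved by no non-identity automorphism of $G$. -}

module Defs where

open import Data.Nat using (ℕ; zero; suc; _+_; _*_; _≤_)
open import Data.Fin using (Fin; splitAt; remQuot; _≟_)
open import Data.Fin.Permutation using (Permutation′; _⟨$⟩ʳ_)
open import Data.Bool using (Bool; true; false; _∧_)
open import Data.Product using (_×_; _,_; ∃)
open import Data.Sum using (_⊎_; inj₁; inj₂)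
open import Relation.Nullary using (yes; no; ¬_)
open import Relation.Nullary.Decidable using (⌊_⌋)
open import Relation.Binary.PropositionalEquality using (_≡_; refl; sym)

record Graph : Set where
  field
    n     : ℕ
    adj   : Fin n → Fin n → Bool
    adj-sym : ∀ u v → adj u v ≡ adj v u
    irrefl : ∀ v → adj v v ≡ false
open Graph public

data Walk (G : Graph) : Fin (n G) → Fin (n G) → Set where
  here : ∀ {u} → Walk G u u
  step : ∀ {u v w} → adj G u v ≡ true → Walk G v w → Walk G u w

Connected : Graph → Set
Connected G = 1 ≤ n G × (∀ u v → Walk G u v)

IsAutomorphism : (G : Graph) → Permutation′ (n G) → Set
IsAutomorphism G σ = ∀ u v → adj G (σ ⟨$⟩ʳ u) (σ ⟨$⟩ʳ v) ≡ adj G u v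

IsDistinguishing : (G : Graph) (r : ℕ) → (Fin (n G) → Fin r) → Set
IsDistinguishing G r c =
  ∀ (σ : Permutation′ (n G)) → IsAutomorphism G σ →
  (∀ v → c (σ ⟨$⟩ʳ v) ≡ c v) → ∀ v → σ ⟨$⟩ʳ v ≡ v

Distinguishable : Graph → ℕ → Set
Distinguishable G r = ∃ λ (c : Fin (n G) → Fin r) → IsDistinguishing G r c

IsDistinguishingNumber : Graph → ℕ → Set
IsDistinguishingNumber G d =
  Distinguishable G d × (∀ r → Distinguishable G r → d ≤ r)

-- Corona G ∘ H.  Vertices: Fin (nG + nG * nH); via splitAt / remQuot a vertex
-- is either a vertex i of G (inj₁ i) or the pair (i , x) = vertex x of the
-- i-th copy of H (inj₂).
eqF : ∀ {k} → Fin k → Fin k → Bool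
eqF i j = ⌊ i ≟ j ⌋

eqF-sym : ∀ {k} (i j : Fin k) → eqF i j ≡ eqF j i
eqF-sym i j with i ≟ j | j ≟ i
... | yes _ | yes _ = refl
... | no _  | no _  = refl
... | yes p | no q  = Data.Empty.⊥-elim (q (sym p)) where import Data.Empty
... | no p  | yes q = Data.Empty.⊥-elim (p (sym q)) where import Data.Empty

eqF-refl : ∀ {k} (i : Fin k) → eqF i i ≡ true
eqF-refl i with i ≟ i
... | yes _ = refl
... | no p  = Data.Empty.⊥-elim (p refl) where import Data.Empty

module _ (G H : Graph) where
  private
    N = n G
    M = n H

  coronaAdjP : Fin N ⊎ (Fin N × Fin M) → Fin N ⊎ (Fin N × Fin M) → Bool
  coronaAdjP (inj₁ i) (inj₁ j) = adj G i j
  coronaAdjP (inj₁ i) (inj₂ (j , _)) = eqF i j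
  coronaAdjP (inj₂ (i , _)) (inj₁ j) = eqF i j
  coronaAdjP (inj₂ (i , x)) (inj₂ (j , y)) = eqF i j ∧ adj H x y

  toPart : Fin (N + N * M) → Fin N ⊎ (Fin N × Fin M)
  toPart u with splitAt N u
  ... | inj₁ i = inj₁ i
  ... | inj₂ k = inj₂ (remQuot M k)

  coronaAdjP-sym : ∀ p q → coronaAdjP p q ≡ coronaAdjP q p
  coronaAdjP-sym (inj₁ i) (inj₁ j) = Graph.adj-sym G i j
  coronaAdjP-sym (inj₁ i) (inj₂ (j , _)) = eqF-sym i j
  coronaAdjP-sym (inj₂ (i , _)) (inj₁ j) = eqF-sym i j
  coronaAdjP-sym (inj₂ (i , x)) (inj₂ (j , y))
    rewrite eqF-sym i j | Graph.adj-sym H x y = refl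

  coronaAdjP-irrefl : ∀ p → coronaAdjP p p ≡ false
  coronaAdjP-irrefl (inj₁ i) = irrefl G i
  coronaAdjP-irrefl (inj₂ (i , x)) rewrite eqF-refl i = irrefl H x

  corona : Graph
  corona = record
    { n = N + N * M
    ; adj = λ u v → coronaAdjP (toPart u) (toPart v)
    ; adj-sym = λ u v → coronaAdjP-sym (toPart u) (toPart v)
    ; irrefl = λ v → coronaAdjP-irrefl (toPart v)
    }

-- Colour the vertices of G with a distinguishing D(G)-labelling, which uses at most D(H) colours,
-- and every copy of H with the same distinguishing D(H)-labelling. The vertices of G are
-- recognisable inside G ∘ H: a vertex of a copy of H has a neighbour (its root) adjacent to all
-- its other neighbours, whereas a vertex of G has a pendant copy of H and, G being connected
-- with at least two vertices, a neighbour in G, and no vertex is adjacent to both. So an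
-- automorphism preserving the labelling permutes V(G), hence fixes it, hence maps every copy
-- of H to itself, hence fixes it as well. Conversely, a distinguishing labelling of G ∘ H
-- restricts to a distinguishing labelling of any single copy of H, because every automorphism
-- of H extends to G ∘ H by acting on that copy alone.
module Submission where

open import Defs
open import Data.Nat using (ℕ; _≤_; _*_; suc; zero)
open import Data.Bool using (Bool; true; false; _∧_)
open import Data.Empty using (⊥-elim)
open import Data.Fin using (Fin; zero; suc; fromℕ<; splitAt; combine; join; _↑ʳ_; inject≤; _≟_)
open import Data.Fin.Permutation using (Permutation′; _⟨$⟩ʳ_)
import Data.Fin.Permutation as Permutation
open import Data.Fin.Properties
  using (splitAt-join; remQuot-combine; combine-remQuot; splitAt⁻¹-↑ˡ; splitAt⁻¹-↑ʳ; inject≤-injective)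
open import Data.Product using (_×_; _,_; ∃; proj₁; proj₂)
open import Data.Sum using (_⊎_; inj₁; inj₂)
open import Data.Sum.Properties using (inj₁-injective)
open import Function using (_∘_; _↔_; Inverse; mk↔ₛ′)
open import Function.Definitions using (Injective)
open import Function.Properties.Inverse using (↔-sym; ↔-trans)
open import Relation.Nullary using (¬_; yes; no)
open import Relation.Binary.PropositionalEquality
  using (_≡_; _≢_; refl; sym; trans; cong; cong₂; subst; module ≡-Reasoning)

open Inverse using (to; from; strictlyInverseˡ; strictlyInverseʳ)

module _ {X : Set} (adjacent : X → X → Bool) where

  IsAutomorphismOf : X ↔ X → Set
  IsAutomorphismOf σ = ∀ u v → adjacent (to σ u) (to σ v) ≡ adjacent u v

  IsDistinguishingFor : {L : Set} → (X → L) → Set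
  IsDistinguishingFor c =
    ∀ σ → IsAutomorphismOf σ → (∀ v → c (to σ v) ≡ c v) → ∀ v → to σ v ≡ v

  HasDominatingNeighbour : X → Set
  HasDominatingNeighbour u =
    ∃ λ w → adjacent u w ≡ true × (∀ z → adjacent u z ≡ true → z ≡ w ⊎ adjacent w z ≡ true)

  module _ {σ : X ↔ X} (σ-aut : IsAutomorphismOf σ) where

    automorphism-sym : IsAutomorphismOf (↔-sym σ)
    automorphism-sym u v = begin
      adjacent (from σ u) (from σ v)                ≡⟨ σ-aut (from σ u) (from σ v) ⟨
      adjacent (to σ (from σ u)) (to σ (from σ v))  ≡⟨ cong₂ adjacent (strictlyInverseˡ σ u) (strictlyInverseˡ σ v) ⟩
      adjacent u v                                  ∎
      where open ≡-Reasoning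

    automorphism-preserves-dominatingNeighbour :
      ∀ {u} → HasDominatingNeighbour u → HasDominatingNeighbour (to σ u)
    automorphism-preserves-dominatingNeighbour {u} (w , u~w , dominated) =
      to σ w , trans (σ-aut u w) u~w , image-dominated
      where
      image-dominated : ∀ z → adjacent (to σ u) z ≡ true → z ≡ to σ w ⊎ adjacent (to σ w) z ≡ true
      image-dominated z σu~z with dominated (from σ z) (trans (sym (σ-aut u (from σ z)))
                                   (trans (cong (adjacent (to σ u)) (strictlyInverseˡ σ z)) σu~z))
      ... | inj₁ z≡w = inj₁ (trans (sym (strictlyInverseˡ σ z)) (cong (to σ) z≡w))
      ... | inj₂ w~z = inj₂ (trans (cong (adjacent (to σ w)) (sym (strictlyInverseˡ σ z)))
                             (trans (σ-aut w (from σ z)) w~z))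

distinguishing-∘-injective : ∀ {X L L′ : Set} {adjacent : X → X → Bool} {c : X → L} {h : L → L′} →
  Injective _≡_ _≡_ h → IsDistinguishingFor adjacent c → IsDistinguishingFor adjacent (h ∘ c)
distinguishing-∘-injective h-injective c-distinguishing σ σ-aut preserved =
  c-distinguishing σ σ-aut (h-injective ∘ preserved)

-- σ is fixed because its conjugate e ∘ σ ∘ e⁻¹ is.
distinguishing-transport : ∀ {X Y L : Set} {a : X → X → Bool} {b : Y → Y → Bool} {c : Y → L}
  (e : X ↔ Y) → (∀ u v → a u v ≡ b (to e u) (to e v)) →
  IsDistinguishingFor b c → IsDistinguishingFor a (c ∘ to e)
distinguishing-transport {Y = Y} {b = b} {c} e e-iso c-distinguishing σ σ-aut preserved v = begin
  to σ v                    ≡⟨ strictlyInverseʳ e (to σ v) ⟨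
  from e (to e (to σ v))    ≡⟨ cong (from e ∘ to e ∘ to σ) (strictlyInverseʳ e v) ⟨
  from e (to τ (to e v))    ≡⟨ cong (from e) (τ-fixes (to e v)) ⟩
  from e (to e v)           ≡⟨ strictlyInverseʳ e v ⟩
  v                         ∎
  where
  open ≡-Reasoning
  τ : Y ↔ Y
  τ = ↔-trans (↔-sym e) (↔-trans σ e)
  back : ∀ y → to e (from e y) ≡ y
  back = strictlyInverseˡ e
  τ-aut : IsAutomorphismOf b τ
  τ-aut u w = trans (sym (e-iso (to σ (from e u)) (to σ (from e w))))
                (trans (σ-aut (from e u) (from e w)) (trans (e-iso (from e u) (from e w))
                  (cong₂ b (back u) (back w))))
  τ-preserves : ∀ y → c (to τ y) ≡ c y
  τ-preserves y = trans (preserved (from e y)) (cong c (back y))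
  τ-fixes : ∀ y → to τ y ≡ y
  τ-fixes = c-distinguishing τ τ-aut τ-preserves

PreservesImage : ∀ {X S : Set} → X ↔ X → (S → X) → Set
PreservesImage σ ι = ∀ s → ∃ λ t → to σ (ι s) ≡ ι t

module _ {X S : Set} (σ : X ↔ X) {ι : S → X} (ι-injective : Injective _≡_ _≡_ ι)
         (σ-preserves : PreservesImage σ ι) (σ⁻¹-preserves : PreservesImage (↔-sym σ) ι) where

  restrict : S ↔ S
  restrict = mk↔ₛ′ (proj₁ ∘ σ-preserves) (proj₁ ∘ σ⁻¹-preserves) inverseˡ inverseʳ
    where
    inverseˡ : ∀ s → proj₁ (σ-preserves (proj₁ (σ⁻¹-preserves s))) ≡ s
    inverseˡ s = ι-injective (trans (sym (proj₂ (σ-preserves _)))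
                   (trans (cong (to σ) (sym (proj₂ (σ⁻¹-preserves s)))) (strictlyInverseˡ σ (ι s))))
    inverseʳ : ∀ s → proj₁ (σ⁻¹-preserves (proj₁ (σ-preserves s))) ≡ s
    inverseʳ s = ι-injective (trans (sym (proj₂ (σ⁻¹-preserves _)))
                   (trans (cong (from σ) (sym (proj₂ (σ-preserves s)))) (strictlyInverseʳ σ (ι s))))

  fixes-preserved-image : ∀ {L : Set} {a : X → X → Bool} {b : S → S → Bool} {c : X → L} →
    (∀ s s′ → a (ι s) (ι s′) ≡ b s s′) → IsDistinguishingFor b (c ∘ ι) →
    IsAutomorphismOf a σ → (∀ v → c (to σ v) ≡ c v) → ∀ s → to σ (ι s) ≡ ι s
  fixes-preserved-image {a = a} {b} {c} induced distinguishing σ-aut preserved s =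
    trans (commutes s) (cong ι (distinguishing restrict restrict-aut restrict-preserves s))
    where
    commutes : ∀ s → to σ (ι s) ≡ ι (to restrict s)
    commutes s = proj₂ (σ-preserves s)
    restrict-aut : IsAutomorphismOf b restrict
    restrict-aut s s′ = begin
      b (to restrict s) (to restrict s′)          ≡⟨ induced _ _ ⟨
      a (ι (to restrict s)) (ι (to restrict s′))  ≡⟨ cong₂ a (commutes s) (commutes s′) ⟨
      a (to σ (ι s)) (to σ (ι s′))                ≡⟨ σ-aut (ι s) (ι s′) ⟩
      a (ι s) (ι s′)                              ≡⟨ induced s s′ ⟩
      b s s′                                      ∎
      where open ≡-Reasoning
    restrict-preserves : ∀ s → c (ι (to restrict s)) ≡ c (ι s)
    restrict-preserves s = trans (cong c (sym (commutes s))) (preserved (ι s))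

fixed-sym : ∀ {X : Set} (σ : X ↔ X) {v} → to σ v ≡ v → from σ v ≡ v
fixed-sym σ {v} σv≡v = trans (cong (from σ) (sym σv≡v)) (strictlyInverseʳ σ v)

eqF-true⇒≡ : ∀ {k} {i j : Fin k} → eqF i j ≡ true → i ≡ j
eqF-true⇒≡ {i = i} {j} _ with i ≟ j
eqF-true⇒≡ _  | yes i≡j = i≡j
eqF-true⇒≡ () | no _

module _ (G H : Graph) where
  private
    N K : ℕ
    N = n G
    K = n H

  CoronaVertex : Set
  CoronaVertex = Fin N ⊎ (Fin N × Fin K)

  private
    coronaAdj : CoronaVertex → CoronaVertex → Bool
    coronaAdj = coronaAdjP G H

  inCopy : Fin N → Fin K → CoronaVertex
  inCopy i x = inj₂ (i , x)

  inCopy-injective : ∀ i → Injective _≡_ _≡_ (inCopy i)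
  inCopy-injective i refl = refl

  fromCoronaVertex : CoronaVertex → Fin (n (corona G H))
  fromCoronaVertex (inj₁ i)       = join N (N * K) (inj₁ i)
  fromCoronaVertex (inj₂ (i , x)) = join N (N * K) (inj₂ (combine i x))

  corona↔CoronaVertex : Fin (n (corona G H)) ↔ CoronaVertex
  corona↔CoronaVertex = mk↔ₛ′ (toPart G H) fromCoronaVertex to-from from-to
    where
    to-from : ∀ p → toPart G H (fromCoronaVertex p) ≡ p
    to-from (inj₁ i) rewrite splitAt-join N (N * K) (inj₁ i) = refl
    to-from (inj₂ (i , x))
      rewrite splitAt-join N (N * K) (inj₂ (combine i x)) | remQuot-combine {N} {K} i x = refl
    from-to : ∀ u → fromCoronaVertex (toPart G H u) ≡ u
    from-to u with splitAt N u in eq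
    ... | inj₁ i = splitAt⁻¹-↑ˡ eq
    ... | inj₂ k = trans (cong (N ↑ʳ_) (combine-remQuot {N} K k)) (splitAt⁻¹-↑ʳ eq)

  fromCoronaVertex-adj : ∀ p q → coronaAdj p q ≡ adj (corona G H) (fromCoronaVertex p) (fromCoronaVertex q)
  fromCoronaVertex-adj p q = sym (cong₂ coronaAdj (back p) (back q))
    where
    back : ∀ p → toPart G H (fromCoronaVertex p) ≡ p
    back = strictlyInverseˡ corona↔CoronaVertex

  mapCopies : (Fin N → Fin K → Fin K) → CoronaVertex → CoronaVertex
  mapCopies _ (inj₁ i)       = inj₁ i
  mapCopies f (inj₂ (i , x)) = inCopy i (f i x)

  mapCopies-inverse : ∀ {f g : Fin N → Fin K → Fin K} → (∀ i x → f i (g i x) ≡ x) →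
    ∀ p → mapCopies f (mapCopies g p) ≡ p
  mapCopies-inverse _       (inj₁ _)       = refl
  mapCopies-inverse inverse (inj₂ (i , x)) = cong (inCopy i) (inverse i x)

  onCopies : (Fin N → Permutation′ K) → CoronaVertex ↔ CoronaVertex
  onCopies π = mk↔ₛ′ (mapCopies (to ∘ π)) (mapCopies (from ∘ π))
    (mapCopies-inverse (strictlyInverseˡ ∘ π)) (mapCopies-inverse (strictlyInverseʳ ∘ π))

  onCopies-automorphism : ∀ {π} → (∀ i → IsAutomorphism H (π i)) → IsAutomorphismOf coronaAdj (onCopies π)
  onCopies-automorphism π-aut (inj₁ _)       (inj₁ _)       = refl
  onCopies-automorphism π-aut (inj₁ _)       (inj₂ _)       = refl
  onCopies-automorphism π-aut (inj₂ _)       (inj₁ _)       = refl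
  onCopies-automorphism π-aut (inj₂ (i , x)) (inj₂ (j , y)) with i ≟ j
  ... | yes refl = π-aut i x y
  ... | no _     = refl

  onlyAt : Fin N → Permutation′ K → Fin N → Permutation′ K
  onlyAt i₀ τ i with i ≟ i₀
  ... | yes _ = τ
  ... | no _  = Permutation.id

  onlyAt-self : ∀ i₀ τ x → onlyAt i₀ τ i₀ ⟨$⟩ʳ x ≡ τ ⟨$⟩ʳ x
  onlyAt-self i₀ τ x with i₀ ≟ i₀
  ... | yes _ = refl
  ... | no i₀≢i₀ = ⊥-elim (i₀≢i₀ refl)

  onlyAt-automorphism : ∀ i₀ {τ} → IsAutomorphism H τ → ∀ i → IsAutomorphism H (onlyAt i₀ τ i)
  onlyAt-automorphism i₀ τ-aut i with i ≟ i₀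
  ... | yes _ = τ-aut
  ... | no _  = λ _ _ → refl

  copy-distinguishing : ∀ {r} {c : CoronaVertex → Fin r} → IsDistinguishingFor coronaAdj c →
    ∀ i → IsDistinguishing H r (c ∘ inCopy i)
  copy-distinguishing {c = c} c-distinguishing i₀ τ τ-aut τ-preserves x =
    trans (sym (onlyAt-self i₀ τ x))
      (inCopy-injective i₀ (c-distinguishing (onCopies (onlyAt i₀ τ))
        (onCopies-automorphism {onlyAt i₀ τ} (onlyAt-automorphism i₀ τ-aut)) preserves (inCopy i₀ x)))
    where
    preserves : ∀ p → c (mapCopies (to ∘ onlyAt i₀ τ) p) ≡ c p
    preserves (inj₁ _) = refl
    preserves (inj₂ (i , x)) with i ≟ i₀
    ... | yes refl = τ-preserves x
    ... | no _     = refl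

  copyVertex-dominated : ∀ i x → HasDominatingNeighbour coronaAdj (inCopy i x)
  copyVertex-dominated i x = inj₁ i , eqF-refl i , dominated
    where
    dominated : ∀ z → coronaAdj (inCopy i x) z ≡ true → z ≡ inj₁ i ⊎ coronaAdj (inj₁ i) z ≡ true
    dominated (inj₁ j) i~j with refl ← eqF-true⇒≡ {i = i} {j} i~j = inj₁ refl
    dominated (inj₂ (j , _)) i~j with eqF i j
    dominated (inj₂ _) _  | true  = inj₂ refl
    dominated (inj₂ _) () | false

  automorphism-preserves-copies : ∀ σ → IsAutomorphismOf coronaAdj σ →
    (∀ i → to σ (inj₁ i) ≡ inj₁ i) → ∀ i → PreservesImage σ (inCopy i)
  automorphism-preserves-copies σ σ-aut roots-fixed i x with to σ (inCopy i x) in σx≡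
  ... | inj₁ j with () ← trans (sym (strictlyInverseʳ σ (inCopy i x)))
                          (trans (cong (from σ) σx≡) (fixed-sym σ (roots-fixed j)))
  ... | inj₂ (i′ , y) with refl ← eqF-true⇒≡ {i = i} {i′}
        (trans (sym (cong₂ coronaAdj (roots-fixed i) σx≡)) (trans (σ-aut (inj₁ i) (inCopy i x)) (eqF-refl i)))
        = y , refl

  module _ (neighbour : ∀ i → ∃ λ j → adj G i j ≡ true) (x₀ : Fin K) where

    -- Its pendant vertex inCopy i x₀ and a neighbour j in G have no common neighbour.
    root-undominated : ∀ i → ¬ HasDominatingNeighbour coronaAdj (inj₁ i)
    root-undominated i (inj₁ k , i~k , dominated) with dominated (inCopy i x₀) (eqF-refl i)
    ... | inj₂ k~i with refl ← eqF-true⇒≡ {i = k} {i} k~i with () ← trans (sym i~k) (irrefl G k)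
    root-undominated i (inj₂ (k , y) , i~k , dominated) with neighbour i
    ... | j , i~j with dominated (inj₁ j) i~j
    ... | inj₂ k~j with refl ← eqF-true⇒≡ {i = k} {j} k~j | refl ← eqF-true⇒≡ {i = i} {k} i~k
                   with () ← trans (sym i~j) (irrefl G i)

    automorphism-preserves-roots : ∀ σ → IsAutomorphismOf coronaAdj σ → PreservesImage σ inj₁
    automorphism-preserves-roots σ σ-aut i with to σ (inj₁ i) in σi≡
    ... | inj₁ j = j , refl
    ... | inj₂ (j , y) = ⊥-elim (root-undominated i
          (subst (HasDominatingNeighbour coronaAdj) (strictlyInverseʳ σ (inj₁ i))
            (automorphism-preserves-dominatingNeighbour coronaAdj {↔-sym σ} (automorphism-sym coronaAdj {σ} σ-aut)
              (subst (HasDominatingNeighbour coronaAdj) (sym σi≡) (copyVertex-dominated j y)))))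

    module _ {dG dH} (dG≤dH : dG ≤ dH) (cG : Fin N → Fin dG) (cH : Fin K → Fin dH) where

      coronaLabelling : CoronaVertex → Fin dH
      coronaLabelling (inj₁ i)       = inject≤ (cG i) dG≤dH
      coronaLabelling (inj₂ (_ , x)) = cH x

      coronaLabelling-distinguishing : IsDistinguishing G dG cG → IsDistinguishing H dH cH →
        IsDistinguishingFor coronaAdj coronaLabelling
      coronaLabelling-distinguishing cG-distinguishing cH-distinguishing σ σ-aut preserved = fixed
        where
        σ⁻¹-aut : IsAutomorphismOf coronaAdj (↔-sym σ)
        σ⁻¹-aut = automorphism-sym coronaAdj {σ} σ-aut
        roots-fixed : ∀ i → to σ (inj₁ i) ≡ inj₁ i
        roots-fixed = fixes-preserved-image σ inj₁-injective
          (automorphism-preserves-roots σ σ-aut) (automorphism-preserves-roots (↔-sym σ) σ⁻¹-aut) (λ _ _ → refl)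
          (distinguishing-∘-injective (inject≤-injective dG≤dH dG≤dH _ _) cG-distinguishing) σ-aut preserved
        copies-fixed : ∀ i x → to σ (inCopy i x) ≡ inCopy i x
        copies-fixed i = fixes-preserved-image σ (inCopy-injective i)
          (automorphism-preserves-copies σ σ-aut roots-fixed i)
          (automorphism-preserves-copies (↔-sym σ) σ⁻¹-aut (fixed-sym σ ∘ roots-fixed) i)
          (λ x y → cong (_∧ adj H x y) (eqF-refl i)) cH-distinguishing σ-aut preserved
        fixed : ∀ p → to σ p ≡ p
        fixed (inj₁ i)       = roots-fixed i
        fixed (inj₂ (i , x)) = copies-fixed i x

another-vertex : ∀ {k} → k ≢ 1 → (i : Fin k) → ∃ λ j → i ≢ j
another-vertex {suc zero}    k≢1 zero    = ⊥-elim (k≢1 refl)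
another-vertex {suc (suc _)} _   zero    = suc zero , λ ()
another-vertex {suc (suc _)} _   (suc _) = zero , λ ()

walk-first-step : ∀ {G u w} → Walk G u w → u ≢ w → ∃ λ v → adj G u v ≡ true
walk-first-step here       u≢u = ⊥-elim (u≢u refl)
walk-first-step (step u~v _) _ = _ , u~v

connected-has-neighbour : ∀ {G} → Connected G → n G ≢ 1 → ∀ i → ∃ λ j → adj G i j ≡ true
connected-has-neighbour (_ , walk) n≢1 i with j , i≢j ← another-vertex n≢1 i = walk-first-step (walk i j) i≢j

mainTheorem9 : (G H : Graph) → Connected G → Connected H → n G ≢ 1 →
    (dG dH : ℕ) → IsDistinguishingNumber G dG → IsDistinguishingNumber H dH →
    dG ≤ dH → IsDistinguishingNumber (corona G H) dH
mainTheorem9 G H G-connected (1≤nH , _) nG≢1 dG dH ((cG , cG-distinguishing) , _)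
             ((cH , cH-distinguishing) , dH-least) dG≤dH =
  (coronaLabelling G H neighbour x₀ dG≤dH cG cH ∘ toPart G H ,
   distinguishing-transport (corona↔CoronaVertex G H) (λ _ _ → refl)
     (coronaLabelling-distinguishing G H neighbour x₀ dG≤dH cG cH cG-distinguishing cH-distinguishing)) ,
  λ r (c , c-distinguishing) → dH-least r (_ , copy-distinguishing G H
    (distinguishing-transport (↔-sym (corona↔CoronaVertex G H)) (fromCoronaVertex-adj G H) c-distinguishing)
    (fromℕ< (proj₁ G-connected)))
  where
  neighbour : ∀ i → ∃ λ j → adj G i j ≡ true
  neighbour = connected-has-neighbour G-connected nG≢1
  x₀ : Fin (n H)
  x₀ = fromℕ< 1≤nH
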